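{- Let $A\subseteq[n]$. The map $W_A\to CF_A$, $w\mapsto\overline{w}$, is a bijection.
   Context: Let $A=\{a_1<\dots<a_m\}\subseteq[n]$, $[k]=\{1,\dots,k\}$. $W_A$ is the set of words $w=w_1\cdots w_m$ in which each element of $A$ appears exactly once; $w^{ -1}\colon A\to[m]$ is given by $w^{ -1}(w_i)=i$. The contraction of $w\in W_A$ is $\overline{w}\colon A\to[m]$, $\overline{w}(a)=w^{ -1}(a)-|\{b\in A: b>a,\ w^{ -1}(b)<w^{ -1}(a)\}|$. $CF_A$ is the set of $A$-central parking functions, i.e. functions $f\colon A\to[m]$ with $f(a_j)\le j$ for every $j\in[m]$. -}

module Defs where

open import Data.Nat using (ℕ; zero; suc; _∸_; _≤_; _<_)
import Data.Nat as ℕ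
open import Data.Fin using (Fin; _≟_) renaming (_≤?_ to _≤ᶠ?_; _<?_ to _<ᶠ?_; _<_ to _<ᶠ_)
open import Data.Fin.Subset using (Subset; _∈_; ∣_∣)
open import Data.Fin.Subset.Properties using (_∈?_)
open import Data.List using (List; []; _∷_; length; filter; allFin)
open import Data.List.Relation.Unary.All using (All)
open import Data.Product using (_×_)
open import Relation.Nullary using (yes; no)
open import Relation.Binary.PropositionalEquality using (_≡_)
open import Relation.Nullary.Decidable using (_×-dec_)

-- Convention: [n] is modelled by Fin n (order-preserving shift by one);
-- a subset A ⊆ [n] is a Subset n; m = ∣ A ∣.
-- Values in [m] and positions are genuine natural numbers 1..m.

elems : ∀ {n} → Subset n → List (Fin n)
elems A = filter (λ a → a ∈? A) (allFin _)

-- rank a = j  iff  a = a_j  (for a ∈ A)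
rank : ∀ {n} → Subset n → Fin n → ℕ
rank A a = length (filter (λ b → b ≤ᶠ? a) (elems A))

occ : ∀ {n} → Fin n → List (Fin n) → ℕ
occ a w = length (filter (λ x → a ≟ x) w)

IsWord : ∀ {n} → Subset n → List (Fin n) → Set
IsWord A w = All (λ x → x ∈ A) w × (∀ a → a ∈ A → occ a w ≡ 1)

-- w⁻¹(a): 1-based position of (the first occurrence of) a in w
pos : ∀ {n} → Fin n → List (Fin n) → ℕ
pos a [] = zero
pos a (x ∷ w) with a ≟ x
... | yes _ = 1
... | no  _ = suc (pos a w)

contraction : ∀ {n} → Subset n → List (Fin n) → Fin n → ℕ
contraction A w a =
  pos a w ∸ length (filter (λ b → (a <ᶠ? b) ×-dec (pos b w ℕ.<? pos a w)) (elems A))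

-- CF_A : f : A → [m] with f(a_j) ≤ j   (f given on Fin n, only its values on A matter)
IsCF : ∀ {n} → Subset n → (Fin n → ℕ) → Set
IsCF A f = ∀ a → a ∈ A → (1 ≤ f a) × (f a ≤ ∣ A ∣) × (f a ≤ rank A a)

module Submission where

-- For a word w ∈ W_A and a ∈ A, the letters preceding a in w are either
-- smaller or larger than a; hence w̄(a) = 1 + code a w, where the *code*
-- of a in w counts the letters smaller than a that precede it.  So it
-- suffices to show that w ↦ code · w is a bijection from W_A onto the
-- functions g with g(a_j) < j.  This is the classical insertion (Lehmer)
-- code, proved by induction on the alphabet listed in decreasing order:
-- deleting the largest letter x from w does not change the code of any
-- other letter, while the code of x is the length of the prefix before
-- it.  Conversely, a word is rebuilt by inserting x at position g(x).

open import Defs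
open import Data.Nat using (ℕ; zero; suc; pred; _+_; _∸_; _≤_; _<_; z≤n; s≤s; >-nonZero)
import Data.Nat as ℕ
import Data.Nat.Properties as ℕP
open import Data.Fin using (Fin; zero; suc; toℕ; _≟_)
  renaming (_<_ to _<ᶠ_; _>_ to _>ᶠ_; _<?_ to _<ᶠ?_; _≤?_ to _≤ᶠ?_)
import Data.Fin.Properties as FinP
open import Data.Fin.Subset using (Subset; _∈_; ∣_∣)
open import Data.Fin.Subset.Properties using (_∈?_)
open import Data.Bool using (true; false)
open import Data.Vec using ([]; _∷_)
open import Data.Vec.Base using () renaming (here to vhere; there to vthere)
open import Data.List using (List; []; _∷_; length; filter; allFin; _++_; [_]; map; take; drop)
open import Data.List.Properties
  using (length-++; length-map; length-filter; length-take; take++drop≡id; ∷-injective;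
         filter-accept; filter-reject; filter-all; filter-none; filter-some)
open import Data.List.Membership.Propositional using () renaming (_∈_ to _∈ₗ_; _∉_ to _∉ₗ_)
open import Data.List.Membership.Propositional.Properties
  using (∈-∃++; ∈-++⁺ˡ; ∈-++⁺ʳ; ∈-++⁻; ∈-map⁺; ∈-map⁻; ∈-filter⁺; ∈-filter⁻; ∈-allFin)
open import Data.List.Membership.Propositional.Properties.WithK using (unique∧set⇒bag)
open import Data.List.Relation.Unary.Any using (here; there)
open import Data.List.Relation.Unary.All as All using (All; []; _∷_)
open import Data.List.Relation.Unary.All.Properties using (¬Any⇒All¬; All¬⇒¬Any; take⁺)
import Data.List.Relation.Unary.All.Properties as AllP
open import Data.List.Relation.Unary.AllPairs as AllPairs using (AllPairs; []; _∷_)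
import Data.List.Relation.Unary.AllPairs.Properties as AllPairsP
open import Data.List.Relation.Unary.Unique.Propositional using (Unique)
import Data.List.Relation.Unary.Unique.Propositional.Properties as UniqueP
open import Data.List.Relation.Binary.Sublist.Propositional using (_⊆_; []; _∷_; _∷ʳ_; minimum)
open import Data.List.Relation.Binary.Sublist.Propositional.Properties using (All-resp-⊆; Any-resp-⊆)
open import Data.List.Relation.Binary.Permutation.Propositional using (_↭_; ↭-refl; ↭-sym; ↭-trans; ↭-prep)
open import Data.List.Relation.Binary.Permutation.Propositional.Properties
  using (↭-length; ↭-empty-inv; ∈-resp-↭; filter-↭; shift; drop-mid)
open import Data.List.Relation.Binary.BagAndSetEquality using (∼bag⇒↭)
open import Data.Product using (_×_; _,_; proj₁; proj₂; ∃; ∃₂)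
open import Data.Sum using (inj₁; inj₂)
open import Data.Empty using (⊥-elim)
open import Function.Base using (_∘_)
open import Function.Bundles using (mk⇔)
open import Relation.Nullary using (yes; no)
open import Relation.Unary using (Decidable)
open import Relation.Nullary.Decidable using (_×-dec_)
open import Relation.Binary.Definitions using (tri<; tri≈; tri>)
open import Relation.Binary.PropositionalEquality
  using (_≡_; _≢_; refl; sym; trans; cong; cong₂; subst; module ≡-Reasoning)

unique-↭ : {X : Set} {xs ys : List X} → Unique xs → Unique ys →
           (∀ {z} → z ∈ₗ xs → z ∈ₗ ys) → (∀ {z} → z ∈ₗ ys → z ∈ₗ xs) → xs ↭ ys
unique-↭ uxs uys to from = ∼bag⇒↭ (unique∧set⇒bag uxs uys (mk⇔ to from))

++-cancel-length : {X : Set} (u u′ : List X) {v v′ : List X} →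
                   length u ≡ length u′ → u ++ v ≡ u′ ++ v′ → u ≡ u′ × v ≡ v′
++-cancel-length []      []        _   eq = refl , eq
++-cancel-length (x ∷ u) (x′ ∷ u′) len eq with ∷-injective eq
... | refl , eq′ with ++-cancel-length u u′ (ℕP.suc-injective len) eq′
... | refl , refl = refl , refl

count-cons : {X : Set} {P : X → Set} (P? : Decidable P) (y : X) {l l′ : List X} →
             length (filter P? l) ≡ length (filter P? l′) →
             length (filter P? (y ∷ l)) ≡ length (filter P? (y ∷ l′))
count-cons P? y same with P? y
... | yes _ = cong suc same
... | no  _ = same

module Letters {n : ℕ} where

  occ-↭ : (a : Fin n) {w w′ : List (Fin n)} → w ↭ w′ → occ a w ≡ occ a w′
  occ-↭ a w↭w′ = ↭-length (filter-↭ (a ≟_) w↭w′)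

  occ-head : (a : Fin n) (w : List (Fin n)) → occ a (a ∷ w) ≡ suc (occ a w)
  occ-head a w = cong length (filter-accept (a ≟_) refl)

  occ-other : {a x : Fin n} (w : List (Fin n)) → a ≢ x → occ a (x ∷ w) ≡ occ a w
  occ-other w a≢x = cong length (filter-reject (_ ≟_) a≢x)

  occ-absent : {a : Fin n} {w : List (Fin n)} → a ∉ₗ w → occ a w ≡ 0
  occ-absent a∉w = cong length (filter-none (_ ≟_) (¬Any⇒All¬ _ a∉w))

  occ-unique : {a : Fin n} {w : List (Fin n)} → Unique w → a ∈ₗ w → occ a w ≡ 1
  occ-unique {w = x ∷ w} (x∉w ∷ _) (here refl) =
    trans (occ-head x w) (cong suc (occ-absent (All¬⇒¬Any x∉w)))
  occ-unique {w = x ∷ w} (x∉w ∷ uw) (there a∈w) =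
    trans (occ-other w λ { refl → All¬⇒¬Any x∉w a∈w }) (occ-unique uw a∈w)

  occ≡1⇒unique : (w : List (Fin n)) → (∀ {y} → y ∈ₗ w → occ y w ≡ 1) → Unique w
  occ≡1⇒unique []      _    = []
  occ≡1⇒unique (x ∷ w) once = ¬Any⇒All¬ w x∉w ∷ occ≡1⇒unique w once-in-w
    where
    x∉w : x ∉ₗ w
    x∉w x∈w = ℕP.n≮0 (subst (0 <_) no-more-x (filter-some (x ≟_) x∈w))
      where
      no-more-x : occ x w ≡ 0
      no-more-x = ℕP.suc-injective (trans (sym (occ-head x w)) (once (here refl)))
    once-in-w : ∀ {y} → y ∈ₗ w → occ y w ≡ 1
    once-in-w y∈w = trans (sym (occ-other w λ { refl → x∉w y∈w })) (once (there y∈w))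

  occ≡1⇒∈ : {a : Fin n} (w : List (Fin n)) → occ a w ≡ 1 → a ∈ₗ w
  occ≡1⇒∈ {a} (x ∷ w) once with a ≟ x
  ... | yes a≡x = here a≡x
  ... | no  _   = there (occ≡1⇒∈ w once)

  ↭-unique : {w ds : List (Fin n)} → Unique ds → w ↭ ds → Unique w
  ↭-unique uds w↭ds = occ≡1⇒unique _ λ y∈w →
    trans (occ-↭ _ w↭ds) (occ-unique uds (∈-resp-↭ w↭ds y∈w))

  before : Fin n → List (Fin n) → List (Fin n)
  before a []      = []
  before a (x ∷ w) with a ≟ x
  ... | yes _ = []
  ... | no  _ = x ∷ before a w

  before-⊆ : (a : Fin n) (w : List (Fin n)) → before a w ⊆ w
  before-⊆ a []      = []
  before-⊆ a (x ∷ w) with a ≟ x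
  ... | yes _ = x ∷ʳ minimum w
  ... | no  _ = refl ∷ before-⊆ a w

  before-unique : (a : Fin n) (w : List (Fin n)) → Unique w → Unique (before a w)
  before-unique a []      _           = []
  before-unique a (x ∷ w) (x∉w ∷ uw) with a ≟ x
  ... | yes _ = []
  ... | no  _ = All-resp-⊆ (before-⊆ a w) x∉w ∷ before-unique a w uw

  before-excludes : (a : Fin n) (w : List (Fin n)) → a ∉ₗ before a w
  before-excludes a (x ∷ w) _ with a ≟ x
  before-excludes a (x ∷ w) ()          | yes _
  before-excludes a (x ∷ w) (here a≡x)  | no a≢x = a≢x a≡x
  before-excludes a (x ∷ w) (there a∈)  | no _   = before-excludes a w a∈

  pos-before : {a : Fin n} (w : List (Fin n)) → a ∈ₗ w → pos a w ≡ suc (length (before a w))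
  pos-before {a} (x ∷ w) _ with a ≟ x
  pos-before {a} (x ∷ w) _           | yes _   = refl
  pos-before {a} (x ∷ w) (here a≡x)  | no a≢x = ⊥-elim (a≢x a≡x)
  pos-before {a} (x ∷ w) (there a∈w) | no _    = cong suc (pos-before w a∈w)

  earlier⇒before : {a b : Fin n} (w : List (Fin n)) → b ∈ₗ w → pos b w < pos a w → b ∈ₗ before a w
  earlier⇒before {a} {b} (x ∷ w) _ b<a with a ≟ x | b ≟ x
  ... | yes _ | yes _ = ⊥-elim (ℕP.<-irrefl refl b<a)
  ... | yes _ | no  _ = ⊥-elim (ℕP.n≮0 (ℕP.≤-pred b<a))
  ... | no  _ | yes b≡x = here b≡x
  earlier⇒before (x ∷ w) (here b≡x)  b<a | no _ | no b≢x = ⊥-elim (b≢x b≡x)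
  earlier⇒before (x ∷ w) (there b∈w) b<a | no _ | no _   = there (earlier⇒before w b∈w (ℕP.≤-pred b<a))

  before⇒earlier : {a b : Fin n} (w : List (Fin n)) → a ∈ₗ w → b ∈ₗ before a w → pos b w < pos a w
  before⇒earlier {a} (x ∷ w) _ _ with a ≟ x
  before⇒earlier (x ∷ w) a∈          ()  | yes _
  before⇒earlier (x ∷ w) (here a≡x)  b∈  | no a≢x = ⊥-elim (a≢x a≡x)
  before⇒earlier {b = b} (x ∷ w) (there a∈w) _ | no _ with b ≟ x
  ... | yes _ rewrite pos-before w a∈w = s≤s (s≤s z≤n)
  before⇒earlier (x ∷ w) (there a∈w) (here b≡x)  | no _ | no b≢x = ⊥-elim (b≢x b≡x)
  before⇒earlier (x ∷ w) (there a∈w) (there b∈w) | no _ | no _   = s≤s (before⇒earlier w a∈w b∈w)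

  length-split : (a : Fin n) (xs : List (Fin n)) → a ∉ₗ xs →
    length xs ≡ length (filter (_<ᶠ? a) xs) + length (filter (a <ᶠ?_) xs)
  length-split a []       _   = refl
  length-split a (x ∷ xs) a∉ with FinP.<-cmp x a
  ... | tri< x<a _ x≯a = begin
    suc (length xs)
      ≡⟨ cong suc (length-split a xs (λ p → a∉ (there p))) ⟩
    suc (length (filter (_<ᶠ? a) xs) + length (filter (a <ᶠ?_) xs))
      ≡⟨ cong₂ _+_ (cong length (filter-accept (_<ᶠ? a) x<a))
                   (cong length (filter-reject (a <ᶠ?_) x≯a)) ⟨
    length (filter (_<ᶠ? a) (x ∷ xs)) + length (filter (a <ᶠ?_) (x ∷ xs))
      ∎
    where open ≡-Reasoning
  ... | tri≈ _ x≡a _ = ⊥-elim (a∉ (here (sym x≡a)))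
  ... | tri> x≮a _ a<x = begin
    suc (length xs)
      ≡⟨ cong suc (length-split a xs (λ p → a∉ (there p))) ⟩
    suc (length (filter (_<ᶠ? a) xs) + length (filter (a <ᶠ?_) xs))
      ≡⟨ ℕP.+-suc _ _ ⟨
    length (filter (_<ᶠ? a) xs) + suc (length (filter (a <ᶠ?_) xs))
      ≡⟨ cong₂ _+_ (cong length (filter-reject (_<ᶠ? a) x≮a))
                   (cong length (filter-accept (a <ᶠ?_) a<x)) ⟨
    length (filter (_<ᶠ? a) (x ∷ xs)) + length (filter (a <ᶠ?_) (x ∷ xs))
      ∎
    where open ≡-Reasoning

  code : Fin n → List (Fin n) → ℕ
  code a w = length (filter (_<ᶠ? a) (before a w))


open Letters

module InsertionCode {n : ℕ} where

  Decreasing : List (Fin n) → Set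
  Decreasing = AllPairs _>ᶠ_

  rankIn : List (Fin n) → Fin n → ℕ
  rankIn ds a = length (filter (_≤ᶠ? a) ds)

  rankIn-top : {x : Fin n} {ds : List (Fin n)} → All (_<ᶠ x) ds → rankIn (x ∷ ds) x ≡ suc (length ds)
  rankIn-top {x} ds<x = trans (cong length (filter-accept (_≤ᶠ? x) ℕP.≤-refl))
                              (cong (suc ∘ length) (filter-all (_≤ᶠ? x) (All.map ℕP.<⇒≤ ds<x)))

  rankIn-below : {a x : Fin n} {ds : List (Fin n)} → a <ᶠ x → rankIn (x ∷ ds) a ≡ rankIn ds a
  rankIn-below {a} a<x = cong length (filter-reject (_≤ᶠ? a) (ℕP.<⇒≱ a<x))

  code-top : {x : Fin n} (u v : List (Fin n)) → All (_<ᶠ x) u → code x (u ++ x ∷ v) ≡ length u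
  code-top {x} u v u<x = cong length (trans (cong (filter (_<ᶠ? x)) (before-top u u<x))
                                           (filter-all (_<ᶠ? x) u<x))
    where
    before-top : (u : List (Fin n)) → All (_<ᶠ x) u → before x (u ++ x ∷ v) ≡ u
    before-top [] [] with x ≟ x
    ... | yes _   = refl
    ... | no  x≢x = ⊥-elim (x≢x refl)
    before-top (y ∷ u) (y<x ∷ u<x) with x ≟ y
    ... | yes refl = ⊥-elim (ℕP.<-irrefl refl y<x)
    ... | no  _    = cong (y ∷_) (before-top u u<x)

  code-insert : {a x : Fin n} (u v : List (Fin n)) → a <ᶠ x → code a (u ++ x ∷ v) ≡ code a (u ++ v)
  code-insert {a} {x} [] v a<x with a ≟ x
  ... | yes refl = ⊥-elim (ℕP.<-irrefl refl a<x)
  ... | no  _    = cong length (filter-reject (_<ᶠ? a) (ℕP.<⇒≯ a<x))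
  code-insert {a} (y ∷ u) v a<x with a ≟ y
  ... | yes _ = refl
  ... | no  _ = count-cons (_<ᶠ? a) y (code-insert u v a<x)

  remove-top : {x : Fin n} {ds w : List (Fin n)} → All (_<ᶠ x) ds → w ↭ x ∷ ds →
               ∃₂ λ u v → w ≡ u ++ x ∷ v × All (_<ᶠ x) u × u ++ v ↭ ds
  remove-top {x} ds<x w↭ with ∈-∃++ (∈-resp-↭ (↭-sym w↭) (here refl))
  ... | u , v , refl = u , v , refl , u<x , uv↭
    where
    uv↭ : u ++ v ↭ _
    uv↭ = drop-mid u [] w↭
    u<x : All (_<ᶠ x) u
    u<x = All.tabulate λ y∈u → All.lookup ds<x (∈-resp-↭ uv↭ (∈-++⁺ˡ y∈u))

  code-bound : {ds w : List (Fin n)} → Decreasing ds → w ↭ ds →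
               ∀ {a} → a ∈ₗ ds → code a w < rankIn ds a
  code-bound {x ∷ ds} (ds<x ∷ dec) w↭ a∈ with remove-top ds<x w↭
  code-bound {x ∷ ds} (ds<x ∷ dec) w↭ (here refl) | u , v , refl , u<x , uv↭ = begin-strict
    code x (u ++ x ∷ v)    ≡⟨ code-top u v u<x ⟩
    length u               ≤⟨ ℕP.m≤m+n (length u) (length v) ⟩
    length u + length v    ≡⟨ length-++ u ⟨
    length (u ++ v)        ≡⟨ ↭-length uv↭ ⟩
    length ds              <⟨ ℕP.n<1+n _ ⟩
    suc (length ds)        ≡⟨ rankIn-top ds<x ⟨
    rankIn (x ∷ ds) x      ∎
    where open ℕP.≤-Reasoning
  code-bound {x ∷ ds} (ds<x ∷ dec) w↭ {a} (there a∈) | u , v , refl , u<x , uv↭ = begin-strict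
    code a (u ++ x ∷ v)    ≡⟨ code-insert u v a<x ⟩
    code a (u ++ v)        <⟨ code-bound dec uv↭ a∈ ⟩
    rankIn ds a            ≡⟨ rankIn-below a<x ⟨
    rankIn (x ∷ ds) a      ∎
    where
    open ℕP.≤-Reasoning
    a<x : a <ᶠ x
    a<x = All.lookup ds<x a∈

  code-injective : {ds w w′ : List (Fin n)} → Decreasing ds → w ↭ ds → w′ ↭ ds →
                   (∀ {a} → a ∈ₗ ds → code a w ≡ code a w′) → w ≡ w′
  code-injective {[]} _ w↭ w′↭ _ = trans (↭-empty-inv w↭) (sym (↭-empty-inv w′↭))
  code-injective {x ∷ ds} (ds<x ∷ dec) w↭ w′↭ same
    with remove-top ds<x w↭ | remove-top ds<x w′↭
  ... | u , v , refl , u<x , uv↭ | u′ , v′ , refl , u′<x , u′v′↭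
    with ++-cancel-length u u′ same-prefix same-rest
    where
    same-prefix : length u ≡ length u′
    same-prefix = trans (sym (code-top u v u<x)) (trans (same (here refl)) (code-top u′ v′ u′<x))
    same-rest : u ++ v ≡ u′ ++ v′
    same-rest = code-injective dec uv↭ u′v′↭ λ a∈ → let a<x = All.lookup ds<x a∈ in
      trans (sym (code-insert u v a<x)) (trans (same (there a∈)) (code-insert u′ v′ a<x))
  ... | refl , refl = refl

  -- Every g with g(a) below the rank of a is the code of a permutation:
  -- insert the largest letter x at position g(x) into a word for the rest.
  code-surjective : {ds : List (Fin n)} → Decreasing ds → (g : Fin n → ℕ) →
                    (∀ {a} → a ∈ₗ ds → g a < rankIn ds a) →
                    ∃ λ w → w ↭ ds × (∀ {a} → a ∈ₗ ds → code a w ≡ g a)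
  code-surjective {[]} _ g _ = [] , ↭-refl , λ ()
  code-surjective {x ∷ ds} (ds<x ∷ dec) g bounded
    with code-surjective dec g
           (λ a∈ → subst (g _ <_) (rankIn-below (All.lookup ds<x a∈)) (bounded (there a∈)))
  ... | w′ , w′↭ , codes′ = u ++ x ∷ v , w↭ , codes
    where
    k : ℕ
    k = g x
    u v : List (Fin n)
    u = take k w′
    v = drop k w′
    uv≡w′ : u ++ v ≡ w′
    uv≡w′ = take++drop≡id k w′
    k≤length : k ≤ length w′
    k≤length = subst (k ≤_) (sym (↭-length w′↭))
                 (ℕP.≤-pred (subst (k <_) (rankIn-top ds<x) (bounded (here refl))))
    w′<x : All (_<ᶠ x) w′
    w′<x = All.tabulate λ y∈w′ → All.lookup ds<x (∈-resp-↭ w′↭ y∈w′)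
    w↭ : u ++ x ∷ v ↭ x ∷ ds
    w↭ = ↭-trans (shift x u v) (↭-prep x (subst (_↭ ds) (sym uv≡w′) w′↭))
    codes : ∀ {a} → a ∈ₗ x ∷ ds → code a (u ++ x ∷ v) ≡ g a
    codes (here refl) = trans (code-top u v (take⁺ k w′<x))
                              (trans (length-take k w′) (ℕP.m≤n⇒m⊓n≡m k≤length))
    codes (there a∈)  = trans (code-insert u v (All.lookup ds<x a∈))
                              (trans (cong (code _) uv≡w′) (codes′ a∈))

open InsertionCode

decreasingElems : ∀ {n} → Subset n → List (Fin n)
decreasingElems []          = []
decreasingElems (true  ∷ A) = map suc (decreasingElems A) ++ [ zero ]
decreasingElems (false ∷ A) = map suc (decreasingElems A)

decreasingElems-decreasing : ∀ {n} (A : Subset n) → Decreasing (decreasingElems A)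
decreasingElems-decreasing []          = []
decreasingElems-decreasing (true  ∷ A) =
  AllPairsP.++⁺ shifted ([] ∷ []) (AllP.map⁺ (All.tabulate λ _ → s≤s z≤n ∷ []))
  where
  shifted : Decreasing (map suc (decreasingElems A))
  shifted = AllPairsP.map⁺ (AllPairs.map s≤s (decreasingElems-decreasing A))
decreasingElems-decreasing (false ∷ A) =
  AllPairsP.map⁺ (AllPairs.map s≤s (decreasingElems-decreasing A))

∈-decreasingElems⁺ : ∀ {n} (A : Subset n) {a} → a ∈ A → a ∈ₗ decreasingElems A
∈-decreasingElems⁺ (true  ∷ A) vhere      = ∈-++⁺ʳ (map suc (decreasingElems A)) (here refl)
∈-decreasingElems⁺ (true  ∷ A) (vthere a∈) = ∈-++⁺ˡ (∈-map⁺ suc (∈-decreasingElems⁺ A a∈))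
∈-decreasingElems⁺ (false ∷ A) (vthere a∈) = ∈-map⁺ suc (∈-decreasingElems⁺ A a∈)

∈-decreasingElems⁻ : ∀ {n} (A : Subset n) {a} → a ∈ₗ decreasingElems A → a ∈ A
∈-decreasingElems⁻ (true ∷ A) a∈ with ∈-++⁻ (map suc (decreasingElems A)) a∈
... | inj₂ (here refl) = vhere
... | inj₁ a∈shifted with ∈-map⁻ suc a∈shifted
...   | _ , b∈ , refl = vthere (∈-decreasingElems⁻ A b∈)
∈-decreasingElems⁻ (false ∷ A) a∈ with ∈-map⁻ suc a∈
... | _ , b∈ , refl = vthere (∈-decreasingElems⁻ A b∈)

length-decreasingElems : ∀ {n} (A : Subset n) → length (decreasingElems A) ≡ ∣ A ∣
length-decreasingElems []          = refl
length-decreasingElems (true  ∷ A) = begin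
  length (map suc (decreasingElems A) ++ [ zero ]) ≡⟨ length-++ (map suc (decreasingElems A)) ⟩
  length (map suc (decreasingElems A)) + 1          ≡⟨ ℕP.+-comm _ 1 ⟩
  suc (length (map suc (decreasingElems A)))        ≡⟨ cong suc (length-map suc (decreasingElems A)) ⟩
  suc (length (decreasingElems A))                  ≡⟨ cong suc (length-decreasingElems A) ⟩
  suc ∣ A ∣                                          ∎
  where open ≡-Reasoning
length-decreasingElems (false ∷ A) = trans (length-map suc (decreasingElems A)) (length-decreasingElems A)

module _ {n : ℕ} (A : Subset n) where

  ∈-elems⁺ : ∀ {b} → b ∈ A → b ∈ₗ elems A
  ∈-elems⁺ b∈A = ∈-filter⁺ (_∈? A) (∈-allFin _) b∈A

  ∈-elems⁻ : ∀ {b} → b ∈ₗ elems A → b ∈ A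
  ∈-elems⁻ b∈ = proj₂ (∈-filter⁻ (_∈? A) {xs = allFin n} b∈)

  elems-unique : Unique (elems A)
  elems-unique = UniqueP.filter⁺ (_∈? A) (UniqueP.allFin⁺ n)

  elems↭decreasing : elems A ↭ decreasingElems A
  elems↭decreasing = unique-↭ elems-unique (decreasing⇒unique (decreasingElems-decreasing A))
    (λ b∈ → ∈-decreasingElems⁺ A (∈-elems⁻ b∈)) (λ b∈ → ∈-elems⁺ (∈-decreasingElems⁻ A b∈))
    where
    decreasing⇒unique : ∀ {ds} → Decreasing ds → Unique ds
    decreasing⇒unique = AllPairs.map λ y<x x≡y → ℕP.<⇒≢ y<x (cong toℕ (sym x≡y))

  word⇒↭ : {w : List (Fin n)} → IsWord A w → w ↭ elems A
  word⇒↭ {w} (w⊆A , once) = unique-↭ (occ≡1⇒unique w λ y∈w → once _ (All.lookup w⊆A y∈w)) elems-unique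
    (λ b∈w → ∈-elems⁺ (All.lookup w⊆A b∈w)) (λ b∈ → occ≡1⇒∈ w (once _ (∈-elems⁻ b∈)))

  ↭⇒word : {w : List (Fin n)} → w ↭ elems A → IsWord A w
  ↭⇒word w↭ = All.tabulate (λ b∈w → ∈-elems⁻ (∈-resp-↭ w↭ b∈w))
            , λ a a∈A → trans (occ-↭ a w↭) (occ-unique elems-unique (∈-elems⁺ a∈A))

  rank≡rankIn : ∀ a → rank A a ≡ rankIn (decreasingElems A) a
  rank≡rankIn a = ↭-length (filter-↭ (_≤ᶠ? a) elems↭decreasing)

  rank≤size : ∀ a → rank A a ≤ ∣ A ∣
  rank≤size a = subst (rank A a ≤_) (length-decreasingElems A)
    (subst (_≤ length (decreasingElems A)) (sym (rank≡rankIn a)) (length-filter (_≤ᶠ? a) (decreasingElems A)))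

  -- w̄(a) = 1 + code a w: among the letters preceding a, those larger than a
  -- are exactly the ones the contraction subtracts from the position of a.
  contraction-code : {w : List (Fin n)} {a : Fin n} → w ↭ elems A → a ∈ A →
                     contraction A w a ≡ suc (code a w)
  contraction-code {w} {a} w↭ a∈A = begin
    pos a w ∸ length (filter larger-earlier (elems A))
      ≡⟨ cong₂ _∸_ (pos-before w a∈w) (↭-length larger-earlier↭larger-before) ⟩
    suc (length B) ∸ length (filter (a <ᶠ?_) B)
      ≡⟨ cong (λ k → suc k ∸ length (filter (a <ᶠ?_) B)) (length-split a B (before-excludes a w)) ⟩
    suc (code a w) + length (filter (a <ᶠ?_) B) ∸ length (filter (a <ᶠ?_) B)
      ≡⟨ ℕP.m+n∸n≡m (suc (code a w)) (length (filter (a <ᶠ?_) B)) ⟩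
    suc (code a w)
      ∎
    where
    open ≡-Reasoning
    B : List (Fin n)
    B = before a w
    a∈w : a ∈ₗ w
    a∈w = ∈-resp-↭ (↭-sym w↭) (∈-elems⁺ a∈A)
    larger-earlier : Decidable (λ b → a <ᶠ b × pos b w < pos a w)
    larger-earlier = λ b → (a <ᶠ? b) ×-dec (pos b w ℕ.<? pos a w)
    to : ∀ {b} → b ∈ₗ filter larger-earlier (elems A) → b ∈ₗ filter (a <ᶠ?_) B
    to b∈ with ∈-filter⁻ larger-earlier {xs = elems A} b∈
    ... | b∈A , a<b , earlier =
      ∈-filter⁺ (a <ᶠ?_) (earlier⇒before w (∈-resp-↭ (↭-sym w↭) b∈A) earlier) a<b
    from : ∀ {b} → b ∈ₗ filter (a <ᶠ?_) B → b ∈ₗ filter larger-earlier (elems A)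
    from b∈ with ∈-filter⁻ (a <ᶠ?_) {xs = B} b∈
    ... | b∈B , a<b = ∈-filter⁺ larger-earlier
      (∈-resp-↭ w↭ (Any-resp-⊆ (before-⊆ a w) b∈B)) (a<b , before⇒earlier w a∈w b∈B)
    larger-earlier↭larger-before : filter larger-earlier (elems A) ↭ filter (a <ᶠ?_) B
    larger-earlier↭larger-before = unique-↭ (UniqueP.filter⁺ larger-earlier elems-unique)
      (UniqueP.filter⁺ (a <ᶠ?_) (before-unique a w (↭-unique elems-unique w↭))) to from

  -- w̄ ∈ CF_A: 1 ≤ w̄(a) ≤ rank a ≤ m, since the code of a is below its rank.
  contraction-central : (w : List (Fin n)) → IsWord A w → IsCF A (contraction A w)
  contraction-central w word a a∈A rewrite contraction-code (word⇒↭ word) a∈A =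
    s≤s z≤n , ℕP.≤-trans below-rank (rank≤size a) , below-rank
    where
    below-rank : code a w < rank A a
    below-rank = subst (code a w <_) (sym (rank≡rankIn a))
      (code-bound (decreasingElems-decreasing A) (↭-trans (word⇒↭ word) elems↭decreasing)
                  (∈-decreasingElems⁺ A a∈A))

  contraction-injective : (w w′ : List (Fin n)) → IsWord A w → IsWord A w′ →
    (∀ a → a ∈ A → contraction A w a ≡ contraction A w′ a) → w ≡ w′
  contraction-injective w w′ word word′ same =
    code-injective (decreasingElems-decreasing A)
      (↭-trans (word⇒↭ word) elems↭decreasing) (↭-trans (word⇒↭ word′) elems↭decreasing)
      λ a∈ → let a∈A = ∈-decreasingElems⁻ A a∈ in ℕP.suc-injective
        (trans (sym (contraction-code (word⇒↭ word) a∈A))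
               (trans (same _ a∈A) (contraction-code (word⇒↭ word′) a∈A)))

  -- A central parking function f is the contraction of the word with codes f − 1.
  contraction-surjective : (f : Fin n → ℕ) → IsCF A f →
    ∃ λ (w : List (Fin n)) → IsWord A w × (∀ a → a ∈ A → contraction A w a ≡ f a)
  contraction-surjective f central
    with code-surjective (decreasingElems-decreasing A) (pred ∘ f) codes-bounded
    where
    codes-bounded : ∀ {a} → a ∈ₗ decreasingElems A → pred (f a) < rankIn (decreasingElems A) a
    codes-bounded {a} a∈ with central a (∈-decreasingElems⁻ A a∈)
    ... | 1≤fa , _ , fa≤rank = subst (_≤ rankIn (decreasingElems A) a)
      (sym (ℕP.suc-pred (f a) {{>-nonZero 1≤fa}})) (subst (f a ≤_) (rank≡rankIn a) fa≤rank)
  ... | w , w↭ , codes = w , ↭⇒word w↭elems , λ a a∈A →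
    trans (contraction-code w↭elems a∈A)
      (trans (cong suc (codes (∈-decreasingElems⁺ A a∈A)))
             (ℕP.suc-pred (f a) {{>-nonZero (proj₁ (central a a∈A))}}))
    where
    w↭elems : w ↭ elems A
    w↭elems = ↭-trans w↭ (↭-sym elems↭decreasing)

corollary3p3 : (n : ℕ) (A : Subset n) →
    ((w : List (Fin n)) → IsWord A w → IsCF A (contraction A w))
    × ((w w′ : List (Fin n)) → IsWord A w → IsWord A w′ →
         (∀ a → a ∈ A → contraction A w a ≡ contraction A w′ a) → w ≡ w′)
    × ((f : Fin n → ℕ) → IsCF A f →
         ∃ λ (w : List (Fin n)) → IsWord A w × (∀ a → a ∈ A → contraction A w a ≡ f a))
corollary3p3 n A = contraction-central A , contraction-injective A , contraction-surjective A
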